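{- If a structure $\mathcal{M}$ has the strong Erdős–Hajnal property, then every structure trace definable in $\mathcal{M}$ has the strong Erdős–Hajnal property.
   Context: A structure $\mathcal{O}$ has the strong Erdős–Hajnal property if for every $\mathcal{O}$-definable $X \subseteq O^m \times O^n$ there is a real $\delta > 0$ such that for all finite $A \subseteq O^m$, $B \subseteq O^n$ there are $A' \subseteq A$, $B' \subseteq B$ with $|A'| \geq \delta|A|$, $|B'| \geq \delta|B|$, and $A' \times B'$ either contained in or disjoint from $X$. Trace definability: for structures $\mathcal{O},\mathcal{M}$ and an injection $\tau : O \to M^m$, $\mathcal{M}$ trace defines $\mathcal{O}$ via $\tau$ if for every $\mathcal{O}$-definable (with parameters) $X \subseteq O^n$ there is an $\mathcal{M}$-definable (with parameters) $Y \subseteq M^{mn}$ with $X = \{(a_1,\dots,a_n) \in O^n : (\tau(a_1),\dots,\tau(a_n)) \in Y\}$; $\mathcal{O}$ is trace definable in $\mathcal{M}$ if this holds for some such injection. -}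

module Defs where

open import Data.Nat using (ℕ; zero; suc; _+_; _*_)
open import Data.Fin using (Fin)
open import Data.Vec using (Vec; lookup; _∷_; []; _++_; concat; map)
open import Data.List using (List; length)
open import Data.List.Membership.Propositional using (_∈_)
open import Data.List.Relation.Binary.Subset.Propositional using (_⊆_)
open import Data.List.Relation.Unary.Unique.Propositional using (Unique)
open import Data.Product using (Σ; _×_; _,_; ∃)
open import Data.Sum using (_⊎_)
open import Data.Empty using (⊥)
open import Data.Unit using (⊤)
open import Data.Integer using (+_)
open import Data.Rational using (ℚ; _/_; Positive) renaming (_*_ to _*ℚ_; _≤_ to _≤ℚ_)
open import Relation.Nullary using (¬_)
open import Relation.Binary.PropositionalEquality using (_≡_)
open import Function.Bundles using (_⇔_)
open import Function.Definitions using (Injective)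

record Language : Set₁ where
  field
    Func : ℕ → Set   -- function symbols of each arity (constants: arity 0)
    Rel  : ℕ → Set

record Structure (L : Language) : Set₁ where
  open Language L
  field
    Carrier : Set
    funᴵ    : ∀ {k} → Func k → Vec Carrier k → Carrier
    relᴵ    : ∀ {k} → Rel k → Vec Carrier k → Set

open Structure public

data Term (L : Language) (n : ℕ) : Set where
  var : Fin n → Term L n
  app : ∀ {k} → Language.Func L k → Vec (Term L n) k → Term L n

data Formula (L : Language) : ℕ → Set where
  ⊤ᶠ ⊥ᶠ : ∀ {n} → Formula L n
  _≐_   : ∀ {n} → Term L n → Term L n → Formula L n
  rel   : ∀ {n k} → Language.Rel L k → Vec (Term L n) k → Formula L n
  ¬ᶠ_   : ∀ {n} → Formula L n → Formula L n
  _∧ᶠ_ _∨ᶠ_ _⇒ᶠ_ : ∀ {n} → Formula L n → Formula L n → Formula L n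
  ∀ᶠ ∃ᶠ : ∀ {n} → Formula L (suc n) → Formula L n

module _ {L : Language} (𝓜 : Structure L) where
  private M = Carrier 𝓜

  mutual
    evalT : ∀ {n} → Term L n → Vec M n → M
    evalT (var i)    ρ = lookup ρ i
    evalT (app f ts) ρ = funᴵ 𝓜 f (evalTs ts ρ)

    evalTs : ∀ {n k} → Vec (Term L n) k → Vec M n → Vec M k
    evalTs []       ρ = []
    evalTs (t ∷ ts) ρ = evalT t ρ ∷ evalTs ts ρ

  Sat : ∀ {n} → Formula L n → Vec M n → Set
  Sat ⊤ᶠ         ρ = ⊤
  Sat ⊥ᶠ         ρ = ⊥
  Sat (s ≐ t)    ρ = evalT s ρ ≡ evalT t ρ
  Sat (rel R ts) ρ = relᴵ 𝓜 R (evalTs ts ρ)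
  Sat (¬ᶠ φ)     ρ = ¬ Sat φ ρ
  Sat (φ ∧ᶠ ψ)   ρ = Sat φ ρ × Sat ψ ρ
  Sat (φ ∨ᶠ ψ)   ρ = Sat φ ρ ⊎ Sat ψ ρ
  Sat (φ ⇒ᶠ ψ)   ρ = Sat φ ρ → Sat ψ ρ
  Sat (∀ᶠ φ)     ρ = (a : M) → Sat φ (a ∷ ρ)
  Sat (∃ᶠ φ)     ρ = Σ M (λ a → Sat φ (a ∷ ρ))

  Definable : (n : ℕ) → (Vec M n → Set) → Set
  Definable n X =
    Σ ℕ λ k → Σ (Formula L (n + k)) λ φ → Σ (Vec M k) λ ps →
      (x : Vec M n) → X x ⇔ Sat φ (x ++ ps)

  -- cardinality of a finite set (duplicate-free list) as a rational
  card : ∀ {m} → List (Vec M m) → ℚ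
  card A = (+ length A) / 1

  -- strong Erdős–Hajnal property; O^m × O^n is identified with O^(m+n)
  StrongErdosHajnal : Set₁
  StrongErdosHajnal =
    (m n : ℕ) (X : Vec M (m + n) → Set) → Definable (m + n) X →
    Σ ℚ λ δ → Positive δ ×
      ((A : List (Vec M m)) (B : List (Vec M n)) → Unique A → Unique B →
        Σ (List (Vec M m)) λ A' → Σ (List (Vec M n)) λ B' →
          Unique A' × Unique B' × A' ⊆ A × B' ⊆ B ×
          (δ *ℚ card A ≤ℚ card A') × (δ *ℚ card B ≤ℚ card B') ×
          ( (∀ {a b} → a ∈ A' → b ∈ B' → X (a ++ b))
          ⊎ (∀ {a b} → a ∈ A' → b ∈ B' → ¬ X (a ++ b))))

TraceDefinesVia : ∀ {L L'} (𝓞 : Structure L) (𝓜 : Structure L') (m : ℕ) →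
                  (Carrier 𝓞 → Vec (Carrier 𝓜) m) → Set₁
TraceDefinesVia 𝓞 𝓜 m τ =
  Injective _≡_ _≡_ τ ×
  ((n : ℕ) (X : Vec (Carrier 𝓞) n → Set) → Definable 𝓞 n X →
    Σ (Vec (Carrier 𝓜) (n * m) → Set) λ Y → Definable 𝓜 (n * m) Y ×
      ((a : Vec (Carrier 𝓞) n) → X a ⇔ Y (concat (map τ a))))

TraceDefinable : ∀ {L L'} (𝓞 : Structure L) (𝓜 : Structure L') → Set₁
TraceDefinable 𝓞 𝓜 =
  Σ ℕ λ m → Σ (Carrier 𝓞 → Vec (Carrier 𝓜) m) λ τ → TraceDefinesVia 𝓞 𝓜 m τ

module Submission where

-- A trace embedding τ : O → M^k induces injections O^j → M^(jk) under which every definable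
-- X ⊆ O^(m+n) is the trace of a definable Y ⊆ M^(mk+nk). Applying the property of 𝓜 to the
-- images of A and B gives a δ-large homogeneous pair for Y; its preimage has the same size
-- (the injections preserve length) and is homogeneous for X, so the same δ works for 𝓞.

open import Defs
open import Data.Nat using (ℕ; suc; _+_; _*_)
open import Data.Nat.Properties using (+-assoc; *-distribʳ-+)
open import Data.Vec using (Vec; _∷_; []; _++_; concat; map; cast)
open import Data.Vec.Properties using (++-injective; ++-assoc-eqFree; cast-++ʳ)
open import Data.Vec.Relation.Binary.Equality.Cast using (cast-is-id; cast-trans)
open import Data.List using (List; length) renaming (_∷_ to _∷ₗ_; [] to []ₗ; map to mapₗ)
open import Data.List.Properties using (length-map)
open import Data.List.Membership.Propositional using (_∈_)
open import Data.List.Membership.Propositional.Properties using (∈-map⁻; ∈-map⁺)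
open import Data.List.Relation.Unary.Any using (here; there)
open import Data.List.Relation.Binary.Subset.Propositional using (_⊆_)
open import Data.List.Relation.Unary.Unique.Propositional using (Unique)
import Data.List.Relation.Unary.Unique.Propositional.Properties as Unique
open import Data.Product using (Σ; ∃; _×_; _,_; proj₁; proj₂)
open import Data.Sum using (_⊎_; inj₁; inj₂)
open import Data.Integer using (+_)
open import Data.Rational using (ℚ; _/_; Positive) renaming (_*_ to _*ℚ_; _≤_ to _≤ℚ_)
open import Function using (_∘_)
open import Function.Bundles using (_⇔_; Equivalence)
open import Function.Definitions using (Injective)
open import Relation.Binary.PropositionalEquality
open import Relation.Nullary using (¬_)

module _ {A B : Set} {k : ℕ} (f : A → Vec B k) where

  concat-map-++ : ∀ {m n} .(e : m * k + n * k ≡ (m + n) * k) (xs : Vec A m) (ys : Vec A n) →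
                  cast e (concat (map f xs) ++ concat (map f ys)) ≡ concat (map f (xs ++ ys))
  concat-map-++ e []       ys = cast-is-id e (concat (map f ys))
  concat-map-++ {m = suc m} {n} e (x ∷ xs) ys = begin
    cast e ((f x ++ concat (map f xs)) ++ concat (map f ys))
      ≡⟨ cast-trans (+-assoc k (m * k) (n * k)) e' _ ⟨
    cast e' (cast (+-assoc k (m * k) (n * k)) ((f x ++ concat (map f xs)) ++ concat (map f ys)))
      ≡⟨ cong (cast e') (++-assoc-eqFree (f x) (concat (map f xs)) (concat (map f ys))) ⟩
    cast e' (f x ++ (concat (map f xs) ++ concat (map f ys)))
      ≡⟨ cast-++ʳ distrib (f x) ⟩
    f x ++ cast distrib (concat (map f xs) ++ concat (map f ys))
      ≡⟨ cong (f x ++_) (concat-map-++ distrib xs ys) ⟩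
    f x ++ concat (map f (xs ++ ys)) ∎
    where
    open ≡-Reasoning
    distrib : m * k + n * k ≡ (m + n) * k
    distrib = sym (*-distribʳ-+ k m n)
    e' : k + (m * k + n * k) ≡ k + (m + n) * k
    e' = cong (_+_ k) distrib

  concat-map-injective : Injective _≡_ _≡_ f →
                         ∀ {m} → Injective _≡_ _≡_ (λ (xs : Vec A m) → concat (map f xs))
  concat-map-injective f-inj {x = []}     {[]}     _  = refl
  concat-map-injective f-inj {x = x ∷ xs} {y ∷ ys} eq with ++-injective (f x) (f y) eq
  ... | fx≡fy , rest≡ = cong₂ _∷_ (f-inj fx≡fy) (concat-map-injective f-inj rest≡)

Definable-cast : ∀ {L} (𝓜 : Structure L) {p q : ℕ} (e : q ≡ p) {Y : Vec (Carrier 𝓜) p → Set} →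
                 Definable 𝓜 p Y → Definable 𝓜 q (Y ∘ cast e)
Definable-cast 𝓜 refl {Y} (j , φ , ps , Y⇔φ) =
  j , φ , ps , λ v → subst (λ w → Y w ⇔ Sat 𝓜 φ (v ++ ps)) (sym (cast-is-id refl v)) (Y⇔φ v)

⊆-map⁻ : ∀ {A B : Set} (f : A → B) {xs : List A} {ys : List B} →
         ys ⊆ mapₗ f xs → ∃ λ zs → zs ⊆ xs × mapₗ f zs ≡ ys
⊆-map⁻ f {ys = []ₗ} _ = []ₗ , (λ ()) , refl
⊆-map⁻ f {ys = y ∷ₗ ys} y∷ys⊆ with ∈-map⁻ f (y∷ys⊆ (here refl)) | ⊆-map⁻ f (y∷ys⊆ ∘ there)
... | x , x∈xs , refl | zs , zs⊆xs , refl =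
  x ∷ₗ zs , (λ { (here refl) → x∈xs ; (there z∈zs) → zs⊆xs z∈zs }) , refl

Homogeneous : ∀ {P Q : Set} → (P → Q → Set) → List P → List Q → Set
Homogeneous R A B = (∀ {a b} → a ∈ A → b ∈ B → R a b) ⊎ (∀ {a b} → a ∈ A → b ∈ B → ¬ R a b)

Homogeneous-map⁻ : ∀ {P Q P' Q' : Set} {R : P → Q → Set} {R' : P' → Q' → Set}
                   (f : P → P') (g : Q → Q') → (∀ a b → R a b ⇔ R' (f a) (g b)) →
                   ∀ {A B} → Homogeneous R' (mapₗ f A) (mapₗ g B) → Homogeneous R A B
Homogeneous-map⁻ f g R⇔R' (inj₁ all-R') = inj₁ λ {a} {b} a∈A b∈B →
  Equivalence.from (R⇔R' a b) (all-R' (∈-map⁺ f a∈A) (∈-map⁺ g b∈B))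
Homogeneous-map⁻ f g R⇔R' (inj₂ no-R') = inj₂ λ {a} {b} a∈A b∈B Rab →
  no-R' (∈-map⁺ f a∈A) (∈-map⁺ g b∈B) (Equivalence.to (R⇔R' a b) Rab)

-- Since _/_ normalises through gcd, Agda cannot recover δ or the lists from a Large type;
-- lemmas about it take them explicitly.
Large : ∀ {P : Set} → ℚ → List P → List P → Set
Large δ A A' = δ *ℚ ((+ length A) / 1) ≤ℚ ((+ length A') / 1)

Large-map⁻ : ∀ {P P' : Set} (δ : ℚ) (f : P → P') (A A' : List P) →
             Large δ (mapₗ f A) (mapₗ f A') → Large δ A A'
Large-map⁻ δ f A A' =
  subst₂ (λ l l' → δ *ℚ ((+ l) / 1) ≤ℚ ((+ l') / 1)) (length-map f A) (length-map f A')

HomogeneousPair : ∀ {P Q : Set} → (P → Q → Set) → ℚ → List P → List Q → Set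
HomogeneousPair {P} {Q} R δ A B =
  Σ (List P) λ A' → Σ (List Q) λ B' →
    Unique A' × Unique B' × A' ⊆ A × B' ⊆ B × Large δ A A' × Large δ B B' × Homogeneous R A' B'

HomogeneousPair-map⁻ : ∀ {P Q P' Q' : Set} {R : P → Q → Set} {R' : P' → Q' → Set} {δ : ℚ}
                       (f : P → P') (g : Q → Q') → (∀ a b → R a b ⇔ R' (f a) (g b)) →
                       ∀ {A B} → HomogeneousPair R' δ (mapₗ f A) (mapₗ g B) →
                       HomogeneousPair R δ A B
HomogeneousPair-map⁻ {δ = δ} f g R⇔R' {A} {B}
  (fA' , gB' , fA'! , gB'! , fA'⊆fA , gB'⊆gB , fA'-large , gB'-large , hom)
  with ⊆-map⁻ f fA'⊆fA | ⊆-map⁻ g gB'⊆gB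
... | A' , A'⊆A , refl | B' , B'⊆B , refl =
  A' , B' , Unique.map⁻ fA'! , Unique.map⁻ gB'! , A'⊆A , B'⊆B ,
  Large-map⁻ δ f A A' fA'-large , Large-map⁻ δ g B B' gB'-large , Homogeneous-map⁻ f g R⇔R' hom

ErdosHajnalFor : ∀ {P Q : Set} → (P → Q → Set) → Set
ErdosHajnalFor R =
  Σ ℚ λ δ → Positive δ × (∀ A B → Unique A → Unique B → HomogeneousPair R δ A B)

ErdosHajnalFor-map⁻ : ∀ {P Q P' Q' : Set} {R : P → Q → Set} {R' : P' → Q' → Set}
                      {f : P → P'} {g : Q → Q'} → Injective _≡_ _≡_ f → Injective _≡_ _≡_ g →
                      (∀ a b → R a b ⇔ R' (f a) (g b)) → ErdosHajnalFor R' → ErdosHajnalFor R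
ErdosHajnalFor-map⁻ {f = f} {g} f-injective g-injective R⇔R' (δ , δ>0 , homogeneous-R') =
  δ , δ>0 , λ A B A! B! →
    HomogeneousPair-map⁻ {δ = δ} f g R⇔R'
      (homogeneous-R' (mapₗ f A) (mapₗ g B) (Unique.map⁺ f-injective A!) (Unique.map⁺ g-injective B!))

proposition4p10 : {L L' : Language} (𝓜 : Structure L') (𝓞 : Structure L) →
                  StrongErdosHajnal 𝓜 → TraceDefinable 𝓞 𝓜 → StrongErdosHajnal 𝓞
proposition4p10 𝓜 𝓞 seh-𝓜 (k , τ , τ-injective , trace) m n X X-definable =
  ErdosHajnalFor-map⁻ τ*-injective τ*-injective X⇔Y-split
    (seh-𝓜 (m * k) (n * k) (Y ∘ cast e) (Definable-cast 𝓜 e Y-definable))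
  where
  τ* : ∀ {j} → Vec (Carrier 𝓞) j → Vec (Carrier 𝓜) (j * k)
  τ* a = concat (map τ a)

  τ*-injective : ∀ {j} → Injective _≡_ _≡_ (τ* {j})
  τ*-injective = concat-map-injective τ τ-injective

  e : m * k + n * k ≡ (m + n) * k
  e = sym (*-distribʳ-+ k m n)

  Y : Vec (Carrier 𝓜) ((m + n) * k) → Set
  Y = proj₁ (trace (m + n) X X-definable)

  Y-definable : Definable 𝓜 ((m + n) * k) Y
  Y-definable = proj₁ (proj₂ (trace (m + n) X X-definable))

  X⇔Y-split : ∀ a b → X (a ++ b) ⇔ Y (cast e (τ* a ++ τ* b))
  X⇔Y-split a b = subst (λ v → X (a ++ b) ⇔ Y v) (sym (concat-map-++ τ e a b))
                        (proj₂ (proj₂ (trace (m + n) X X-definable)) (a ++ b))
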